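{- Let $q$ be a prime power, $m,k,t$ positive integers, $\mathbf{n}=(n_1,\dots,n_t)$ with $n_1\ge\cdots\ge n_t\ge1$, $N=n_1+\cdots+n_t$, and let $\mathcal{U}=(\mathcal{U}_1,\dots,\mathcal{U}_t)$ be an $[\mathbf{n},k]_{q^m/q}$ system with generator matrix $G=[G_1|\cdots|G_t]$. Let $\mathcal{C}\subseteq\mathbb{F}_{q^m}^N$ be the $\mathbb{F}_{q^m}$-linear code spanned by the rows of $G$ (the code associated to $\mathcal{U}$), and let $\mathcal{C}^\perp=\{x\in\mathbb{F}_{q^m}^N: Gx^T=0\}$. Let $\rho$ be a positive integer. Then $\mathcal{U}$ is sum-rank $\rho$-saturating if and only if $\rho_{\mathrm{srk}}(\mathcal{C}^\perp)=\rho$.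
   Context: An $[\mathbf{n},k]_{q^m/q}$ system is a tuple $(\mathcal{U}_1,\dots,\mathcal{U}_t)$ of $\mathbb{F}_q$-subspaces of $\mathbb{F}_{q^m}^k$ with $\dim_{\mathbb{F}_q}\mathcal{U}_i=n_i$ whose union spans $\mathbb{F}_{q^m}^k$ over $\mathbb{F}_{q^m}$. A generator matrix is $G=[G_1|\cdots|G_t]$ with $G_i\in\mathbb{F}_{q^m}^{k\times n_i}$ whose columns span $\mathcal{U}_i$ over $\mathbb{F}_q$. For an $\mathbb{F}_q$-subspace $W\le\mathbb{F}_{q^m}^k$, $L_W=\{\langle u\rangle_{\mathbb{F}_{q^m}}:u\in W\setminus\{0\}\}\subseteq\mathrm{PG}(k-1,q^m)$. A point set $\mathcal{S}$ is $r$-saturating if every point of $\mathrm{PG}(k-1,q^m)$ lies in the $\mathbb{F}_{q^m}$-span of some $r+1$ points of $\mathcal{S}$ and $r$ is minimal with this property; $\mathcal{U}$ is sum-rank $\rho$-saturating if $L_{\mathcal{U}_1}\cup\cdots\cup L_{\mathcal{U}_t}$ is $(\rho-1)$-saturating. Write $\mathbb{F}_{q^m}^N=\mathbb{F}_{q^m}^{n_1}\oplus\cdots\oplus\mathbb{F}_{q^m}^{n_t}$; for $x=(x_1,\dots,x_t)$, the sum-rank weight is $w(x)=\sum_i\mathrm{rk}(x_i)$, where $\mathrm{rk}(x_i)$ is the $\mathbb{F}_q$-dimension of the $\mathbb{F}_q$-span of the entries of $x_i$, and $d(x,y)=w(x-y)$. The sum-rank covering radius of a code $\mathcal{D}\subseteq\mathbb{F}_{q^m}^N$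 is $\rho_{\mathrm{srk}}(\mathcal{D})=\max_{x\in\mathbb{F}_{q^m}^N}\min_{c\in\mathcal{D}}d(x,c)$. -}

module Defs where

open import Level using (0ℓ)
open import Data.Nat as ℕ using (ℕ; zero; suc; _^_)
open import Data.Nat.Primality using (Prime)
open import Data.Fin using (Fin; zero; suc)
open import Data.List using (List; length)
open import Data.List.Membership.Propositional using (_∈_)
open import Data.List.Relation.Unary.Unique.Propositional using (Unique)
open import Data.Product using (Σ; ∃; ∃-syntax; _×_)
open import Relation.Nullary using (¬_)
open import Relation.Binary.PropositionalEquality using (_≡_)
open import Algebra.Structures using (IsCommutativeRing)

IsPrimePower : ℕ → Set
IsPrimePower q = ∃[ p ] ∃[ e ] (Prime p × 1 ℕ.≤ e × q ≡ p ^ e)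

record FiniteField : Set₁ where
  field
    K : Set
    _+_ _*_ : K → K → K
    -_ : K → K
    0# 1# : K
    isCommutativeRing : IsCommutativeRing _≡_ _+_ _*_ -_ 0# 1#
    0≢1 : ¬ (0# ≡ 1#)
    inverse : ∀ x → ¬ (x ≡ 0#) → ∃[ y ] (x * y ≡ 1#)
    elements : List K
    complete : ∀ x → x ∈ elements
    unique : Unique elements

  card : ℕ
  card = length elements

sumℕ : (t : ℕ) → (Fin t → ℕ) → ℕ
sumℕ zero f = 0
sumℕ (suc t) f = f zero ℕ.+ sumℕ t (λ i → f (suc i))

-- Everything relative to a finite field K = F_{q^m} and the integer q;
-- F_q is the subfield {x ∈ K | x^q = x}.
module FF (F : FiniteField) (q : ℕ) where
  open FiniteField F

  pow : K → ℕ → K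
  pow x zero = 1#
  pow x (suc e) = x * pow x e

  InFq : K → Set
  InFq x = pow x q ≡ x

  sumK : (n : ℕ) → (Fin n → K) → K
  sumK zero f = 0#
  sumK (suc n) f = f zero + sumK n (λ i → f (suc i))

  matVec : {k l : ℕ} → (Fin k → Fin l → K) → (Fin l → K) → Fin k → K
  matVec {l = l} M a r = sumK l (λ j → M r j * a j)

  InColSpanFq : {k l : ℕ} → (Fin k → Fin l → K) → (Fin k → K) → Set
  InColSpanFq {l = l} M u =
    ∃[ a ] ((∀ j → InFq (a j)) × (∀ r → u r ≡ matVec {l = l} M a r))

  -- the columns of M are F_q-linearly independent (so dim_{F_q} U = l)
  FqIndependentCols : {k l : ℕ} → (Fin k → Fin l → K) → Set
  FqIndependentCols {l = l} M =
    ∀ (a : Fin l → K) → (∀ j → InFq (a j)) →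
      (∀ r → matVec {l = l} M a r ≡ 0#) → ∀ j → a j ≡ 0#

  module System (k t : ℕ) (n : Fin t → ℕ)
                (G : (i : Fin t) → Fin k → Fin (n i) → K) where

    -- U_i = F_q-span of the columns of G_i
    InU : Fin t → (Fin k → K) → Set
    InU i u = InColSpanFq {l = n i} (G i) u

    InUnion : (Fin k → K) → Set
    InUnion u = ∃[ i ] InU i u

    KComb : ℕ → (Fin k → K) → Set
    KComb L v = Σ (Fin L → Fin k → K) λ us → Σ (Fin L → K) λ λs →
      ((∀ (j : Fin L) → InUnion (us j)) ×
       (∀ r → v r ≡ sumK L (λ j → λs j * us j r)))

    SpansAll : Set
    SpansAll = ∀ v → ∃[ L ] KComb L v

    IsSystem : Set
    IsSystem = (∀ i → FqIndependentCols {l = n i} (G i)) × SpansAll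

    NonZero : (Fin k → K) → Set
    NonZero v = ∃[ r ] ¬ (v r ≡ 0#)

    -- every point <v> of PG(k-1,q^m) lies in the span of (at most) s points
    -- of L_{U_1} ∪ ... ∪ L_{U_t}  (zero vectors in a combination are unused)
    Covers : ℕ → Set
    Covers s = ∀ v → NonZero v → KComb s v

    Saturating : ℕ → Set
    Saturating r = Covers (suc r) × (∀ r' → r' ℕ.< r → ¬ Covers (suc r'))

    SumRankSaturating : ℕ → Set
    SumRankSaturating ρ = Saturating (ρ ℕ.∸ 1)

    -- words of F_{q^m}^N = F_{q^m}^{n_1} ⊕ ... ⊕ F_{q^m}^{n_t}
    Word : Set
    Word = (i : Fin t) → Fin (n i) → K

    InDual : Word → Set
    InDual x = ∀ r → sumK t (λ i → sumK (n i) (λ j → G i r j * x i j)) ≡ 0#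

  FqSpanDimLE : {l : ℕ} → (Fin l → K) → ℕ → Set
  FqSpanDimLE x r = Σ (Fin r → K) λ b → (∀ j → Σ (Fin r → K) λ a → ((∀ s → InFq (a s)) ×
                              (x j ≡ sumK r (λ s → a s * b s))))

  HasRank : {l : ℕ} → (Fin l → K) → ℕ → Set
  HasRank {l} x r = FqSpanDimLE {l} x r × (∀ r' → FqSpanDimLE {l} x r' → r ℕ.≤ r')

  module Codes (t : ℕ) (n : Fin t → ℕ) where
    Word : Set
    Word = (i : Fin t) → Fin (n i) → K

    sub : Word → Word → Word
    sub x c i j = x i j + (- c i j)

    HasSumRankWeight : Word → ℕ → Set
    HasSumRankWeight x w =
      Σ (Fin t → ℕ) λ rs → ((∀ i → HasRank {n i} (x i) (rs i)) × w ≡ sumℕ t rs)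

    CoveringRadiusIs : (Word → Set) → ℕ → Set
    CoveringRadiusIs D ρ =
      (∀ x → ∃[ c ] (D c × ∃[ w ] (HasSumRankWeight (sub x c) w × w ℕ.≤ ρ))) ×
      (∃[ x ] (∀ c → D c → ∀ w → HasSumRankWeight (sub x c) w → ρ ℕ.≤ w))

module Submission where

-- The syndrome map x ↦ G xᵀ is onto F_{q^m}^k (the U_i span it) and its fibres
-- are the cosets x + C^⊥. If a block x_i has F_q-rank r, its entries are
-- F_q-combinations a_{j1} b_1 + … + a_{jr} b_r, so G_i x_iᵀ = Σ_σ b_σ (G_i a_σ)
-- with every G_i a_σ in U_i; conversely a term c (G_i a) with a over F_q is the
-- syndrome of the rank-one word a c placed in block i. Hence some word of
-- x + C^⊥ has sum-rank weight at most s iff G xᵀ lies in the F_{q^m}-span of s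
-- points of L_{U_1} ∪ … ∪ L_{U_t}: every point is covered by ρ points iff every
-- coset has weight at most ρ, and the minimality of ρ transfers in the same way.

open import Defs
open import Data.Nat using (ℕ; _≤_; _^_)
open import Data.Fin using (Fin)
open import Relation.Binary.PropositionalEquality using (_≡_)
open import Function.Bundles using (_⇔_)
import Data.Fin as Fin

open import Level using (0ℓ)
open import Data.Nat using (zero; suc; _<_; _≤′_; ≤′-refl; ≤′-step; z≤n)
import Data.Nat as ℕ
import Data.Nat.Properties as ℕₚ
open import Data.Fin using (zero; suc)
import Data.Fin.Properties as Finₚ
open import Data.Vec.Functional using (Vector; _∷_; head; tail; updateAt)
open import Data.Vec.Functional.Relation.Binary.Pointwise using (Pointwise)
import Data.List.Relation.Unary.Any as Any
open import Data.List.Membership.Propositional using (lose)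
open import Data.List.Membership.Setoid.Properties using (index-injective)
open import Data.Product using (Σ; ∃; ∃-syntax; _×_; _,_; proj₁; proj₂)
import Data.Product as Product
open import Data.Product.Function.NonDependent.Propositional using (_×-⇔_)
open import Data.Sum using (inj₁; inj₂)
open import Function using (_∘_)
open import Function.Bundles using (mk⇔)
open import Function.Properties.Equivalence using () renaming (trans to ⇔-trans)
open import Relation.Nullary using (¬_; Dec; yes; no; contradiction)
import Relation.Nullary.Decidable as Dec
open import Relation.Nullary.Decidable using (_×-dec_; ¬?)
open import Relation.Unary using (Pred; Decidable)
open import Relation.Binary using (Rel; Reflexive; _Respects_; DecidableEquality)
open import Relation.Binary.PropositionalEquality
  using (refl; sym; trans; cong; cong₂; subst; setoid; _≗_; module ≡-Reasoning)
open import Algebra.Structures using (IsCommutativeRing)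
open import Algebra.Bundles using (CommutativeRing)

-- Functions are only compared pointwise, so existence is decided only for
-- predicates that respect the pointwise relation.
Searchable : (A : Set) → Rel A 0ℓ → Set₁
Searchable A _≈_ = (P : Pred A 0ℓ) → Decidable P → P Respects _≈_ → Dec (∃ P)

searchable-Vector : {A : Set} {_≈_ : Rel A 0ℓ} → Reflexive _≈_ → Searchable A _≈_ →
                    ∀ n → Searchable (Vector A n) (Pointwise _≈_)
searchable-Vector ≈-refl search zero P P? resp with P? (λ ())
... | yes p = yes ((λ ()) , p)
... | no ¬p = no λ (xs , p) → ¬p (resp {xs} (λ ()) p)
searchable-Vector {A} {_≈_} ≈-refl search (suc n) P P? resp =
  Dec.map′ (λ (x , xs , p) → x ∷ xs , p)
           (λ (xs , p) → head xs , tail xs , resp (λ { zero → ≈-refl ; (suc i) → ≈-refl }) p)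
           (search Extends search-tail resp-head)
  where
  Extends : Pred A 0ℓ
  Extends x = ∃ λ xs → P (x ∷ xs)

  search-tail : Decidable Extends
  search-tail x = searchable-Vector ≈-refl search n (P ∘ (x ∷_)) (P? ∘ (x ∷_))
                    (λ xs≈ys → resp (λ { zero → ≈-refl ; (suc i) → xs≈ys i }))

  resp-head : Extends Respects _≈_
  resp-head x≈y (xs , p) = xs , resp (λ { zero → x≈y ; (suc i) → ≈-refl }) p

Least : Pred ℕ 0ℓ → Set
Least P = ∃[ r ] (P r × ∀ r′ → P r′ → r ≤ r′)

module _ {P : Pred ℕ 0ℓ} (P? : Decidable P) where

  -- Search upwards from n; d is the distance to a known witness.
  least-above : ∀ d n → (∀ r → r < n → ¬ P r) → P (d ℕ.+ n) → Least P
  least-above d n none-below p with P? n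
  ... | yes pn = n , pn , λ r pr → ℕₚ.≮⇒≥ (λ r<n → none-below r r<n pr)
  least-above zero n _ p | no ¬pn = contradiction p ¬pn
  least-above (suc d) n none-below p | no ¬pn =
    least-above d (suc n) none-below′ (subst P (sym (ℕₚ.+-suc d n)) p)
    where
    none-below′ : ∀ r → r < suc n → ¬ P r
    none-below′ r r<1+n with ℕₚ.m<1+n⇒m<n∨m≡n r<1+n
    ... | inj₁ r<n = none-below r r<n
    ... | inj₂ refl = ¬pn

  least : ∀ {r} → P r → Least P
  least {r} p = least-above r 0 (λ _ ()) (subst P (sym (ℕₚ.+-identityʳ r)) p)

sumℕ-mono : ∀ t {f g : Fin t → ℕ} → (∀ i → f i ≤ g i) → sumℕ t f ≤ sumℕ t g
sumℕ-mono zero _ = z≤n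
sumℕ-mono (suc t) f≤g = ℕₚ.+-mono-≤ (f≤g zero) (sumℕ-mono t (f≤g ∘ suc))

sumℕ-zero : ∀ t → sumℕ t (λ _ → 0) ≡ 0
sumℕ-zero zero = refl
sumℕ-zero (suc t) = sumℕ-zero t

sumℕ-updateAt-suc : ∀ t (b : Fin t → ℕ) i → sumℕ t (updateAt b i suc) ≡ suc (sumℕ t b)
sumℕ-updateAt-suc (suc t) b zero = refl
sumℕ-updateAt-suc (suc t) b (suc i) =
  trans (cong (b zero ℕ.+_) (sumℕ-updateAt-suc t (tail b) i)) (ℕₚ.+-suc (b zero) _)

module FieldFacts (F : FiniteField) (q : ℕ) where
  open FiniteField F
  open FF F q
  open IsCommutativeRing isCommutativeRing
    using (+-assoc; +-comm; *-assoc; *-comm; +-identityˡ; +-identityʳ; zeroʳ; *-identityˡ)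
  open ≡-Reasoning

  commutativeRing : CommutativeRing 0ℓ 0ℓ
  commutativeRing = record { isCommutativeRing = isCommutativeRing }

  open import Algebra.Properties.Ring (CommutativeRing.ring commutativeRing)
    using (-0#≈0#; -‿+-comm; xyx⁻¹≈y; ⁻¹-anti-homo‿-)
  open import Algebra.Properties.Semiring.Sum (CommutativeRing.semiring commutativeRing)
    using (sum; sum-cong-≗; ∑-distrib-+; ∑-comm; *-distribˡ-sum)

  _≟_ : DecidableEquality K
  x ≟ y = Dec.map′ (index-injective (setoid K) (complete x) (complete y)) (λ { refl → refl })
                   (Any.index (complete x) Fin.≟ Any.index (complete y))

  searchable-K : Searchable K _≡_
  searchable-K P P? _ =
    Dec.map′ Any.satisfied (λ (x , p) → lose (complete x) p) (Any.any? P? elements)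

  searchable-Vector-K : ∀ n → Searchable (Vector K n) (Pointwise _≡_)
  searchable-Vector-K = searchable-Vector refl searchable-K

  x-[x-y]≡y : ∀ x y → x + (- (x + (- y))) ≡ y
  x-[x-y]≡y x y = begin
    x + (- (x + (- y)))  ≡⟨ cong (x +_) (⁻¹-anti-homo‿- x y) ⟩
    x + (y + (- x))      ≡⟨ sym (+-assoc x y (- x)) ⟩
    (x + y) + (- x)      ≡⟨ xyx⁻¹≈y x y ⟩
    y                    ∎

  x*[y*z]≡z*[x*y] : ∀ x y z → x * (y * z) ≡ z * (x * y)
  x*[y*z]≡z*[x*y] x y z = trans (sym (*-assoc x y z)) (*-comm (x * y) z)

  sumK-cong : ∀ l {f g : Fin l → K} → f ≗ g → sumK l f ≡ sumK l g
  sumK-cong zero _ = refl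
  sumK-cong (suc l) f≗g = cong₂ _+_ (f≗g zero) (sumK-cong l (f≗g ∘ suc))

  sumK-zero : ∀ l {f : Fin l → K} → (∀ i → f i ≡ 0#) → sumK l f ≡ 0#
  sumK-zero zero _ = refl
  sumK-zero (suc l) f≗0 = trans (cong₂ _+_ (f≗0 zero) (sumK-zero l (f≗0 ∘ suc))) (+-identityˡ 0#)

  sumK≡sum : ∀ l (f : Fin l → K) → sumK l f ≡ sum f
  sumK≡sum zero _ = refl
  sumK≡sum (suc l) f = cong (f zero +_) (sumK≡sum l (f ∘ suc))

  sumK-+ : ∀ l (f g : Fin l → K) → sumK l (λ i → f i + g i) ≡ sumK l f + sumK l g
  sumK-+ l f g = begin
    sumK l (λ i → f i + g i)  ≡⟨ sumK≡sum l _ ⟩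
    sum (λ i → f i + g i)     ≡⟨ ∑-distrib-+ f g ⟩
    sum f + sum g             ≡⟨ sym (cong₂ _+_ (sumK≡sum l f) (sumK≡sum l g)) ⟩
    sumK l f + sumK l g       ∎

  sumK-*ˡ : ∀ l c (f : Fin l → K) → c * sumK l f ≡ sumK l (λ i → c * f i)
  sumK-*ˡ l c f = begin
    c * sumK l f            ≡⟨ cong (c *_) (sumK≡sum l f) ⟩
    c * sum f               ≡⟨ *-distribˡ-sum c f ⟩
    sum (λ i → c * f i)     ≡⟨ sym (sumK≡sum l _) ⟩
    sumK l (λ i → c * f i)  ∎

  sumK-comm : ∀ l l′ (f : Fin l → Fin l′ → K) →
              sumK l (λ i → sumK l′ (f i)) ≡ sumK l′ (λ j → sumK l (λ i → f i j))
  sumK-comm l l′ f = begin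
    sumK l (λ i → sumK l′ (f i))          ≡⟨ sumK≡sum l _ ⟩
    sum (λ i → sumK l′ (f i))             ≡⟨ sum-cong-≗ (λ i → sumK≡sum l′ (f i)) ⟩
    sum (λ i → sum (f i))                 ≡⟨ ∑-comm f ⟩
    sum (λ j → sum (λ i → f i j))         ≡⟨ sym (sum-cong-≗ (λ j → sumK≡sum l (λ i → f i j))) ⟩
    sum (λ j → sumK l (λ i → f i j))      ≡⟨ sym (sumK≡sum l′ _) ⟩
    sumK l′ (λ j → sumK l (λ i → f i j))  ∎

  sumK-neg : ∀ l (f : Fin l → K) → sumK l (λ i → - f i) ≡ - (sumK l f)
  sumK-neg zero _ = sym -0#≈0#
  sumK-neg (suc l) f = trans (cong ((- f zero) +_) (sumK-neg l (f ∘ suc))) (-‿+-comm (f zero) _)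

  pow-1# : ∀ e → pow 1# e ≡ 1#
  pow-1# zero = refl
  pow-1# (suc e) = trans (cong (1# *_) (pow-1# e)) (*-identityˡ 1#)

  InFq? : Decidable InFq
  InFq? x = pow x q ≟ x

  InFqSpan : ∀ {r} → (Fin r → K) → K → Set
  InFqSpan {r} b y = Σ (Fin r → K) λ a → (∀ s → InFq (a s)) × y ≡ sumK r (λ s → a s * b s)

  InFqSpan? : ∀ {r} (b : Fin r → K) y → Dec (InFqSpan b y)
  InFqSpan? {r} b y =
    searchable-Vector-K r _ (λ a → Finₚ.all? (InFq? ∘ a) ×-dec (y ≟ sumK r (λ s → a s * b s)))
      (λ a≗a′ (inFq , eq) → (λ s → subst InFq (a≗a′ s) (inFq s)) ,
                            trans eq (sumK-cong r (λ s → cong (_* b s) (a≗a′ s))))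

  FqSpanDimLE? : ∀ {l} (x : Fin l → K) r → Dec (FqSpanDimLE x r)
  FqSpanDimLE? x r =
    searchable-Vector-K r _ (λ b → Finₚ.all? (InFqSpan? b ∘ x))
      (λ b≗b′ span j → let (a , inFq , eq) = span j in
                       a , inFq , trans eq (sumK-cong r (λ s → cong (a s *_) (b≗b′ s))))

  FqSpanDimLE-resp : ∀ {l r} {x y : Fin l → K} → x ≗ y → FqSpanDimLE x r → FqSpanDimLE y r
  FqSpanDimLE-resp x≗y (b , span) =
    b , λ j → let (a , inFq , eq) = span j in a , inFq , trans (sym (x≗y j)) eq

  FqSpanDimLE-zero : ∀ {l} {x : Fin l → K} → (∀ j → x j ≡ 0#) → FqSpanDimLE x 0
  FqSpanDimLE-zero x≗0 = (λ ()) , λ j → (λ ()) , (λ ()) , x≗0 j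

  FqSpanDimLE-+* : ∀ {l r} {x a : Fin l → K} → (∀ j → InFq (a j)) → ∀ c →
                   FqSpanDimLE x r → FqSpanDimLE (λ j → x j + (a j * c)) (suc r)
  FqSpanDimLE-+* {a = a} inFq c (b , span) =
    c ∷ b , λ j → let (a′ , inFq′ , eq) = span j in
      a j ∷ a′ , (λ { zero → inFq j ; (suc s) → inFq′ s }) ,
      trans (cong (_+ (a j * c)) eq) (+-comm _ _)

  single : ∀ {t} {n : Fin t → ℕ} i → (Fin (n i) → K) → (i′ : Fin t) → Fin (n i′) → K
  single zero x zero = x
  single zero x (suc i′) = λ _ → 0#
  single (suc i) x zero = λ _ → 0#
  single {n = n} (suc i) x (suc i′) = single {n = n ∘ suc} i x i′

  sumK-single : ∀ t (n : Fin t → ℕ) (H : (i : Fin t) → Fin (n i) → K) i (x : Fin (n i) → K) →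
    sumK t (λ i′ → sumK (n i′) (λ j → H i′ j * single {n = n} i x i′ j))
      ≡ sumK (n i) (λ j → H i j * x j)
  sumK-single (suc t) n H zero x =
    trans (cong (sumK (n zero) (λ j → H zero j * x j) +_)
                (sumK-zero t (λ i′ → sumK-zero (n (suc i′)) (λ j → zeroʳ _))))
          (+-identityʳ _)
  sumK-single (suc t) n H (suc i) x =
    trans (cong₂ _+_ (sumK-zero (n zero) (λ j → zeroʳ _)) (sumK-single t (n ∘ suc) (H ∘ suc) i x))
          (+-identityˡ _)

  RankBounded : ∀ {t} {n : Fin t → ℕ} → ((i : Fin t) → Fin (n i) → K) → (Fin t → ℕ) → Set
  RankBounded y b = ∀ i → FqSpanDimLE (y i) (b i)

  rankBounded-+single : ∀ {t} {n : Fin t → ℕ} {y : (i : Fin t) → Fin (n i) → K} {b} i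
    {a : Fin (n i) → K} → (∀ j → InFq (a j)) → ∀ c → RankBounded y b →
    RankBounded (λ i′ j → y i′ j + single {n = n} i (λ j → a j * c) i′ j) (updateAt b i suc)
  rankBounded-+single zero inFq c bounded zero = FqSpanDimLE-+* inFq c (bounded zero)
  rankBounded-+single zero inFq c bounded (suc i′) =
    FqSpanDimLE-resp (λ _ → sym (+-identityʳ _)) (bounded (suc i′))
  rankBounded-+single (suc i) inFq c bounded zero =
    FqSpanDimLE-resp (λ _ → sym (+-identityʳ _)) (bounded zero)
  rankBounded-+single {n = n} {y} (suc i) inFq c bounded (suc i′) =
    rankBounded-+single {n = n ∘ suc} {y ∘ suc} i inFq c (bounded ∘ suc) i′

module Syndromes (F : FiniteField) (q k t : ℕ) (n : Fin t → ℕ)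
                 (G : (i : Fin t) → Fin k → Fin (n i) → FiniteField.K F) where
  open FiniteField F
  open FF F q
  open FF.System F q k t n G
  open FF.Codes F q t n using (sub; HasSumRankWeight)
  open FieldFacts F q
  open IsCommutativeRing isCommutativeRing
    using (+-assoc; +-comm; distribˡ; +-identityˡ; +-identityʳ; -‿inverseʳ; zeroˡ; zeroʳ)
  open import Algebra.Properties.Ring (CommutativeRing.ring commutativeRing)
    using (-0#≈0#; -‿distribʳ-*)
  open ≡-Reasoning

  blockSyndrome : (i : Fin t) → (Fin (n i) → K) → Fin k → K
  blockSyndrome i x r = sumK (n i) (λ j → G i r j * x j)

  syndrome : Word → Fin k → K
  syndrome y r = sumK t (λ i → blockSyndrome i (y i) r)

  blockSyndrome-*ʳ : ∀ i (a : Fin (n i) → K) c r →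
                     blockSyndrome i (λ j → a j * c) r ≡ c * blockSyndrome i a r
  blockSyndrome-*ʳ i a c r =
    trans (sumK-cong (n i) (λ j → x*[y*z]≡z*[x*y] (G i r j) (a j) c)) (sym (sumK-*ˡ (n i) c _))

  syndrome-zero : syndrome (λ _ _ → 0#) ≗ λ _ → 0#
  syndrome-zero r = sumK-zero t (λ i → sumK-zero (n i) (λ j → zeroʳ _))

  syndrome-+ : ∀ x y → syndrome (λ i j → x i j + y i j) ≗ λ r → syndrome x r + syndrome y r
  syndrome-+ x y r = begin
    sumK t (λ i → sumK (n i) (λ j → G i r j * (x i j + y i j)))
      ≡⟨ sumK-cong t (λ i → sumK-cong (n i) (λ j → distribˡ (G i r j) (x i j) (y i j))) ⟩
    sumK t (λ i → sumK (n i) (λ j → (G i r j * x i j) + (G i r j * y i j)))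
      ≡⟨ sumK-cong t (λ i → sumK-+ (n i) _ _) ⟩
    sumK t (λ i → blockSyndrome i (x i) r + blockSyndrome i (y i) r)
      ≡⟨ sumK-+ t _ _ ⟩
    syndrome x r + syndrome y r ∎

  syndrome-neg : ∀ y → syndrome (λ i j → - y i j) ≗ λ r → - (syndrome y r)
  syndrome-neg y r = begin
    sumK t (λ i → sumK (n i) (λ j → G i r j * (- y i j)))
      ≡⟨ sumK-cong t (λ i → sumK-cong (n i) (λ j → sym (-‿distribʳ-* (G i r j) (y i j)))) ⟩
    sumK t (λ i → sumK (n i) (λ j → - (G i r j * y i j)))
      ≡⟨ sumK-cong t (λ i → sumK-neg (n i) _) ⟩
    sumK t (λ i → - (blockSyndrome i (y i) r))
      ≡⟨ sumK-neg t _ ⟩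
    - (syndrome y r) ∎

  syndrome-sub : ∀ x y → syndrome (sub x y) ≗ λ r → syndrome x r + (- (syndrome y r))
  syndrome-sub x y r = trans (syndrome-+ x (λ i j → - y i j) r) (cong (syndrome x r +_) (syndrome-neg y r))

  syndrome-single : ∀ i x → syndrome (single {n = n} i x) ≗ blockSyndrome i x
  syndrome-single i x r = sumK-single t n (λ i′ j → G i′ r j) i x

  syndrome-coset : ∀ x {c} → InDual c → syndrome (sub x c) ≗ syndrome x
  syndrome-coset x {c} c∈C⊥ r = begin
    syndrome (sub x c) r              ≡⟨ syndrome-sub x c r ⟩
    syndrome x r + (- (syndrome c r)) ≡⟨ cong (λ z → syndrome x r + (- z)) (c∈C⊥ r) ⟩
    syndrome x r + (- 0#)             ≡⟨ cong (syndrome x r +_) -0#≈0# ⟩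
    syndrome x r + 0#                 ≡⟨ +-identityʳ _ ⟩
    syndrome x r                      ∎

  sub-∈C⊥ : ∀ x y → syndrome y ≗ syndrome x → InDual (sub x y)
  sub-∈C⊥ x y y↦x r = begin
    syndrome (sub x y) r               ≡⟨ syndrome-sub x y r ⟩
    syndrome x r + (- (syndrome y r))  ≡⟨ cong (λ z → syndrome x r + (- z)) (y↦x r) ⟩
    syndrome x r + (- (syndrome x r))  ≡⟨ -‿inverseʳ _ ⟩
    0#                                 ∎

  KComb-resp : ∀ {s v v′} → v ≗ v′ → KComb s v → KComb s v′
  KComb-resp v≗v′ (us , cs , inU , eq) = us , cs , inU , λ r → trans (sym (v≗v′ r)) (eq r)

  KComb-zero : ∀ {v} → (∀ r → v r ≡ 0#) → KComb 0 v
  KComb-zero v≗0 = (λ ()) , (λ ()) , (λ ()) , v≗0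

  KComb-cons : ∀ {s u v} → InUnion u → ∀ c → KComb s v → KComb (suc s) (λ r → (c * u r) + v r)
  KComb-cons {u = u} u∈ c (us , cs , inU , eq) =
    u ∷ us , c ∷ cs , (λ { zero → u∈ ; (suc j) → inU j }) , λ r → cong ((c * u r) +_) (eq r)

  KComb-+ : ∀ {a b v w} → KComb a v → KComb b w → KComb (a ℕ.+ b) (λ r → v r + w r)
  KComb-+ {zero} {w = w} (_ , _ , _ , v≗0) comb =
    KComb-resp (λ r → sym (trans (cong (_+ w r) (v≗0 r)) (+-identityˡ (w r)))) comb
  KComb-+ {suc a} {v = v} {w} (us , cs , inU , eq) comb =
    KComb-resp regroup
      (KComb-cons (inU zero) (cs zero) (KComb-+ (tail us , tail cs , inU ∘ suc , λ _ → refl) comb))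
    where
    regroup : ∀ r → (cs zero * us zero r) + (sumK a (λ j → cs (suc j) * us (suc j) r) + w r)
                    ≡ v r + w r
    regroup r = trans (sym (+-assoc _ _ _)) (cong (_+ w r) (sym (eq r)))

  KComb-sum : ∀ m {T : Fin m → Fin k → K} {b : Fin m → ℕ} → (∀ i → KComb (b i) (T i)) →
              KComb (sumℕ m b) (λ r → sumK m (λ i → T i r))
  KComb-sum zero _ = KComb-zero (λ _ → refl)
  KComb-sum (suc m) combs = KComb-+ (combs zero) (KComb-sum m (combs ∘ suc))

  KComb-blockSyndrome : ∀ i {x s} → FqSpanDimLE x s → KComb s (blockSyndrome i x)
  KComb-blockSyndrome i {x} {s} (b , span) =
    (λ σ → blockSyndrome i (column σ)) , b ,
    (λ σ → i , column σ , (λ j → proj₁ (proj₂ (span j)) σ) , λ _ → refl) ,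
    expand
    where
    column : Fin s → Fin (n i) → K
    column σ j = proj₁ (span j) σ

    expand : ∀ r → blockSyndrome i x r ≡ sumK s (λ σ → b σ * blockSyndrome i (column σ) r)
    expand r = begin
      sumK (n i) (λ j → G i r j * x j)
        ≡⟨ sumK-cong (n i) (λ j → cong (G i r j *_) (proj₂ (proj₂ (span j)))) ⟩
      sumK (n i) (λ j → G i r j * sumK s (λ σ → column σ j * b σ))
        ≡⟨ sumK-cong (n i) (λ j → sumK-*ˡ s (G i r j) _) ⟩
      sumK (n i) (λ j → sumK s (λ σ → G i r j * (column σ j * b σ)))
        ≡⟨ sumK-comm (n i) s _ ⟩
      sumK s (λ σ → blockSyndrome i (λ j → column σ j * b σ) r)
        ≡⟨ sumK-cong s (λ σ → blockSyndrome-*ʳ i (column σ) (b σ) r) ⟩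
      sumK s (λ σ → b σ * blockSyndrome i (column σ) r) ∎

  KComb-syndrome : ∀ {y b} → RankBounded y b → KComb (sumℕ t b) (syndrome y)
  KComb-syndrome {y} bounded =
    KComb-sum t {T = λ i → blockSyndrome i (y i)} (λ i → KComb-blockSyndrome i (bounded i))

  syndrome-of-KComb : ∀ s {v} → KComb s v →
    Σ Word λ y → syndrome y ≗ v × Σ (Fin t → ℕ) λ b → RankBounded y b × sumℕ t b ≡ s
  syndrome-of-KComb zero (_ , _ , _ , v≗0) =
    (λ _ _ → 0#) , (λ r → trans (syndrome-zero r) (sym (v≗0 r))) ,
    (λ _ → 0) , (λ _ → FqSpanDimLE-zero (λ _ → refl)) , sumℕ-zero t
  syndrome-of-KComb (suc s) {v} (us , cs , inU , eq)
    with syndrome-of-KComb s (tail us , tail cs , inU ∘ suc , λ _ → refl) | inU zero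
  ... | y , y↦ , b , bounded , Σb≡s | i , a , inFq , u≡Ga =
    y′ , y′↦v , updateAt b i suc , rankBounded-+single i inFq (cs zero) bounded ,
    trans (sumℕ-updateAt-suc t b i) (cong suc Σb≡s)
    where
    y′ : Word
    y′ i′ j = y i′ j + single {n = n} i (λ j → a j * cs zero) i′ j

    rest : Fin k → K
    rest r = sumK s (λ j → cs (suc j) * us (suc j) r)

    y′↦v : syndrome y′ ≗ v
    y′↦v r = begin
      syndrome y′ r
        ≡⟨ syndrome-+ y (single i (λ j → a j * cs zero)) r ⟩
      syndrome y r + syndrome (single i (λ j → a j * cs zero)) r
        ≡⟨ cong₂ _+_ (y↦ r) (syndrome-single i _ r) ⟩
      rest r + blockSyndrome i (λ j → a j * cs zero) r
        ≡⟨ cong (rest r +_) (blockSyndrome-*ʳ i a (cs zero) r) ⟩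
      rest r + (cs zero * blockSyndrome i a r)
        ≡⟨ cong (λ z → rest r + (cs zero * z)) (sym (u≡Ga r)) ⟩
      rest r + (cs zero * us zero r)
        ≡⟨ +-comm _ _ ⟩
      (cs zero * us zero r) + rest r
        ≡⟨ sym (eq r) ⟩
      v r ∎

  syndrome-surjective : SpansAll → ∀ v → ∃[ x ] (syndrome x ≗ v)
  syndrome-surjective spans v =
    let (y , y↦v , _) = syndrome-of-KComb _ (proj₂ (spans v)) in y , y↦v

  InUnion-resp : ∀ {u u′} → u ≗ u′ → InUnion u → InUnion u′
  InUnion-resp u≗u′ (i , a , inFq , eq) = i , a , inFq , λ r → trans (sym (u≗u′ r)) (eq r)

  InUnion? : Decidable InUnion
  InUnion? u = Finₚ.any? λ i →
    searchable-Vector-K (n i) _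
      (λ a → Finₚ.all? (InFq? ∘ a) ×-dec Finₚ.all? (λ r → u r ≟ blockSyndrome i a r))
      (λ a≗a′ (inFq , eq) → (λ j → subst InFq (a≗a′ j) (inFq j)) ,
                            λ r → trans (eq r) (sumK-cong (n i) (λ j → cong (G i r j *_) (a≗a′ j))))

  KComb? : ∀ s v → Dec (KComb s v)
  KComb? s v =
    searchable-Vector (λ _ → refl) (searchable-Vector-K k) s _
      (λ us → searchable-Vector-K s _
         (λ cs → Finₚ.all? (InUnion? ∘ us) ×-dec
                 Finₚ.all? (λ r → v r ≟ sumK s (λ j → cs j * us j r)))
         (λ cs≗cs′ (inU , eq) →
            inU , λ r → trans (eq r) (sumK-cong s (λ j → cong (_* us j r) (cs≗cs′ j)))))
      (λ us≗us′ (cs , inU , eq) → cs , (λ j → InUnion-resp (us≗us′ j) (inU j)) ,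
                                  λ r → trans (eq r) (sumK-cong s (λ j → cong (cs j *_) (us≗us′ j r))))

  sumRankWeight-≤ : ∀ {z b} → RankBounded z b → ∃[ w ] (HasSumRankWeight z w × w ≤ sumℕ t b)
  sumRankWeight-≤ {z} {b} bounded =
    sumℕ t rank , (rank , proj₂ ∘ minRank , refl) ,
    sumℕ-mono t (λ i → proj₂ (proj₂ (minRank i)) (b i) (bounded i))
    where
    minRank : ∀ i → Least (FqSpanDimLE (z i))
    minRank i = least (FqSpanDimLE? (z i)) (bounded i)

    rank : Fin t → ℕ
    rank = proj₁ ∘ minRank

  Within : Word → ℕ → Set
  Within x s = ∃[ c ] (InDual c × ∃[ w ] (HasSumRankWeight (sub x c) w × w ≤ s))

  ¬Covers-0 : Fin k → ¬ Covers 0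
  ¬Covers-0 r₀ cover with cover (λ _ → 1#) (r₀ , 0≢1 ∘ sym)
  ... | _ , _ , _ , 1≗0 = 0≢1 (sym (1≗0 r₀))

  module _ (i₀ : Fin t) where

    KComb-suc : ∀ {s v} → KComb s v → KComb (suc s) v
    KComb-suc comb =
      KComb-resp (λ r → trans (cong (_+ _) (zeroˡ _)) (+-identityˡ _)) (KComb-cons G₀1∈ 0# comb)
      where
      G₀1∈ : InUnion (blockSyndrome i₀ (λ _ → 1#))
      G₀1∈ = i₀ , (λ _ → 1#) , (λ _ → pow-1# q) , λ _ → refl

    KComb-mono′ : ∀ {a b v} → a ≤′ b → KComb a v → KComb b v
    KComb-mono′ ≤′-refl comb = comb
    KComb-mono′ (≤′-step a≤′b) comb = KComb-suc (KComb-mono′ a≤′b comb)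

    KComb-mono : ∀ {a b v} → a ≤ b → KComb a v → KComb b v
    KComb-mono = KComb-mono′ ∘ ℕₚ.≤⇒≤′

    Covers⇒KComb : ∀ {s} → Covers s → ∀ v → KComb s v
    Covers⇒KComb cover v with Finₚ.all? (λ r → v r ≟ 0#)
    ... | yes v≗0 = KComb-mono z≤n (KComb-zero v≗0)
    ... | no v≢0 = cover v (Finₚ.¬∀⟶∃¬ k _ (λ r → v r ≟ 0#) v≢0)

    Within⇒KComb : ∀ {x s} → Within x s → KComb s (syndrome x)
    Within⇒KComb {x} {s} (c , c∈C⊥ , w , (_ , hasRank , w≡Σ) , w≤s) =
      KComb-mono (subst (_≤ s) w≡Σ w≤s)
        (KComb-resp (syndrome-coset x c∈C⊥) (KComb-syndrome (proj₁ ∘ hasRank)))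

    KComb⇒Within : ∀ {x s} → KComb s (syndrome x) → Within x s
    KComb⇒Within {x} {s} comb with syndrome-of-KComb s comb
    ... | y , y↦x , b , bounded , Σb≡s
      with sumRankWeight-≤ (λ i → FqSpanDimLE-resp (λ j → sym (x-[x-y]≡y (x i j) (y i j)))
                                                    (bounded i))
    ...   | w , hasWeight , w≤Σb =
      sub x y , sub-∈C⊥ x y y↦x , w , hasWeight , subst (w ≤_) Σb≡s w≤Σb

    Covers⇔Within : SpansAll → ∀ s → Covers s ⇔ (∀ x → Within x s)
    Covers⇔Within spans s = mk⇔
      (λ cover x → KComb⇒Within (Covers⇒KComb cover (syndrome x)))
      (λ within v _ → let (x , x↦v) = syndrome-surjective spans v in
                      KComb-resp x↦v (Within⇒KComb (within x)))

    ¬Covers⇔∃¬Within : SpansAll → ∀ s → (¬ Covers s) ⇔ (∃[ x ] ¬ Within x s)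
    ¬Covers⇔∃¬Within spans s = mk⇔ to from
      where
      uncovered : ¬ Covers s → ∃[ v ] ¬ KComb s v
      uncovered ¬cover
        with searchable-Vector-K k (λ v → ¬ KComb s v) (λ v → ¬? (KComb? s v))
               (λ v≗v′ ¬comb comb′ → ¬comb (KComb-resp (sym ∘ v≗v′) comb′))
      ... | yes found = found
      ... | no none =
        contradiction (λ v _ → Dec.decidable-stable (KComb? s v) (λ ¬comb → none (v , ¬comb))) ¬cover

      to : ¬ Covers s → ∃[ x ] ¬ Within x s
      to ¬cover =
        let (v , ¬comb) = uncovered ¬cover
            (x , x↦v) = syndrome-surjective spans v
        in x , λ within → ¬comb (KComb-resp x↦v (Within⇒KComb within))

      from : ∃[ x ] ¬ Within x s → ¬ Covers s
      from (x , ¬within) cover = ¬within (KComb⇒Within (Covers⇒KComb cover (syndrome x)))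

  below-uncovered⇔¬Covers : Fin t → Fin k → ∀ ρ′ →
                            (∀ r′ → r′ < ρ′ → ¬ Covers (suc r′)) ⇔ (¬ Covers ρ′)
  below-uncovered⇔¬Covers i₀ r₀ ρ′ = mk⇔ (to ρ′) from
    where
    to : ∀ ρ′ → (∀ r′ → r′ < ρ′ → ¬ Covers (suc r′)) → ¬ Covers ρ′
    to zero _ = ¬Covers-0 r₀
    to (suc r′) below = below r′ (ℕₚ.n<1+n r′)

    from : ¬ Covers ρ′ → ∀ r′ → r′ < ρ′ → ¬ Covers (suc r′)
    from ¬cover r′ r′<ρ′ cover = ¬cover (λ v nz → KComb-mono i₀ r′<ρ′ (cover v nz))

  ∃¬Within⇔far : ∀ s → (∃[ x ] ¬ Within x s) ⇔
    (∃[ x ] (∀ c → InDual c → ∀ w → HasSumRankWeight (sub x c) w → suc s ≤ w))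
  ∃¬Within⇔far s = mk⇔
    (Product.map₂ λ ¬within c c∈C⊥ w hasWeight →
       ℕₚ.≰⇒> λ w≤s → ¬within (c , c∈C⊥ , w , hasWeight , w≤s))
    (Product.map₂ λ far (c , c∈C⊥ , w , hasWeight , w≤s) → ℕₚ.<⇒≱ (far c c∈C⊥ w hasWeight) w≤s)

-- Only k ≥ 1, t ≥ 1 and ρ ≥ 1 (ρ ∸ 1 truncates) are used.
theorem2p5 : (q m k t : ℕ) → IsPrimePower q → 1 ≤ m → 1 ≤ k → 1 ≤ t →
    (F : FiniteField) → FiniteField.card F ≡ q ^ m →
    (n : Fin t → ℕ) → (∀ i j → i Fin.≤ j → n j ≤ n i) → (∀ i → 1 ≤ n i) →
    (G : (i : Fin t) → Fin k → Fin (n i) → FiniteField.K F) →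
    FF.System.IsSystem F q k t n G →
    (ρ : ℕ) → 1 ≤ ρ →
    (FF.System.SumRankSaturating F q k t n G ρ
      ⇔ FF.Codes.CoveringRadiusIs F q t n (FF.System.InDual F q k t n G) ρ)
theorem2p5 q m (suc k) (suc t) _ _ _ _ F _ n _ _ G (_ , spans) (suc ρ′) _ =
  Covers⇔Within zero spans (suc ρ′)
    ×-⇔ ⇔-trans (below-uncovered⇔¬Covers zero zero ρ′)
          (⇔-trans (¬Covers⇔∃¬Within zero spans ρ′) (∃¬Within⇔far ρ′))
  where open Syndromes F q (suc k) (suc t) n G
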